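{- Let $n\ge 3$ and $k\in\{1,\dots,2^{n-1}\}$. Let $\mathbf{x}=\mathrm{decode}_n(2^{n-1}+k-1)$ and $S_k=\{i\in[n]: x_i=1\}$. Define $w^n(k)=\operatorname{code}(\delta(S_k))$. Then \[ w^n(k)=2^{\binom n2}-1-\Big[2^{\binom{n-1}{2}}(k-1)+\sum_{j=1}^{n-2}2^{\binom{j}{2}}\big(S^{2^j}(k)-1\big)\Big], \] with the convention $\binom12=0$.
   Context: For $S\subseteq[n]=\{1,\dots,n\}$, the cut vector $\delta(S)\in\{0,1\}^{\binom n2}$ has coordinates $\delta(S)_{ij}=1$ if $|S\cap\{i,j\}|=1$ and $0$ otherwise, for $1\le i<j\le n$. Coordinates are listed in lexicographic order of the pairs: $(1,2),(1,3),\dots,(1,n),(2,3),\dots,(n-1,n)$. The cut polytope $\operatorname{CUT}(n)$ is the convex hull of all $\delta(S)$, and it has $2^{n-1}$ vertices, namely the $\delta(S_k)$, $k=1,\dots,2^{n-1}$. For a binary vector $\mathbf{y}=(y_1,\dots,y_m)$, $\operatorname{code}(\mathbf{y})=\sum_{j=1}^m y_j2^{m-j}$. For $0\le a<2^n$, $\mathrm{decode}_n(a)$ is the $n$-bit binary representation of $a$, padded with leading zeros, viewed as a vector in $\{0,1\}^n$. Alternating cycle function: for an integer $N\ge2$ and a positive integer $k$, let $q=\lfloor (k-1)/N\rfloor$ and $r=k-qN$. Set $S^N(k)=N+1-r$ if $q$ is even, and $S^N(k)=r$ if $q$ is odd. -}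

module Defs where

open import Data.Nat using (ℕ; zero; suc; _+_; _*_; _∸_; _^_; _≡ᵇ_)
open import Data.Nat.DivMod using (_/_; _%_)
open import Data.Bool using (Bool; true; false; if_then_else_; _xor_)
open import Data.List using (List; []; _∷_; _++_; map; concatMap; foldl)
open import Data.Product using (_×_; _,_)

open import Data.Nat.Properties using (m^n≢0)


upFrom : ℕ → ℕ → List ℕ
upFrom a zero = []
upFrom a (suc m) = a ∷ upFrom (suc a) m

pairs : ℕ → List (ℕ × ℕ)
pairs n = concatMap (λ i → map (λ j → (i , j)) (upFrom (suc i) (n ∸ i))) (upFrom 1 n)

-- A subset S ⊆ [n] is given by its membership predicate on indices 1..n.
Subset : Set
Subset = ℕ → Bool

-- cut vector δ(S) ∈ {0,1}^(n choose 2), coordinates in lexicographic order of pairs: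
-- δ(S)_ij = 1 iff |S ∩ {i,j}| = 1
cutVec : ℕ → Subset → List Bool
cutVec n S = map (λ { (i , j) → S i xor S j }) (pairs n)

-- code(y) = Σ_{j=1}^m y_j 2^(m-j)
code : List Bool → ℕ
code = foldl (λ acc b → 2 * acc + (if b then 1 else 0)) 0

decode : ℕ → ℕ → List Bool
decode n a = map (λ i → (_/_ a (2 ^ (n ∸ i)) {{m^n≢0 2 (n ∸ i)}}) % 2 ≡ᵇ 1) (upFrom 1 n)

-- the i-th entry (1-based) of a list of bits; false outside range
entry : List Bool → ℕ → Bool
entry [] i = false
entry (b ∷ bs) zero = false
entry (b ∷ bs) (suc zero) = b
entry (b ∷ bs) (suc (suc i)) = entry bs (suc i)

Sk : ℕ → ℕ → Subset
Sk n k = entry (decode n (2 ^ (n ∸ 1) + k ∸ 1))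

w : ℕ → ℕ → ℕ
w n k = code (cutVec n (Sk n k))

-- binomial coefficient (j choose 2) = j(j-1)/2 ; gives 0 for j = 0, 1
choose2 : ℕ → ℕ
choose2 j = (j * (j ∸ 1)) / 2

altCycle : (N : ℕ) → .{{Data.Nat.NonZero N}} → ℕ → ℕ
altCycle N k =
  let q = (k ∸ 1) / N
      r = k ∸ q * N
  in if q % 2 ≡ᵇ 0 then suc N ∸ r else r

sumTo : ℕ → (ℕ → ℕ) → ℕ
sumTo zero f = 0
sumTo (suc m) f = sumTo m f + f (suc m)

altCyclePow2 : ℕ → ℕ → ℕ
altCyclePow2 j k = altCycle (2 ^ j) {{m^n≢0 2 j}} k

-- Write x = decode_n(2^(n-1) + k - 1) = (1, y) with y = decode_(n-1)(k - 1). The cut vector is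
-- the concatenation of the rows xᵢ xor (xᵢ₊₁, …, xₙ), and the row of length p is followed by
-- binom(p,2) further coordinates, so 2^binom(n,2) - 1 - w^n(k) = Σ_p 2^binom(p,2) (2^p - 1 - row_p)
-- with rows read in binary. The top row is the complement of y and contributes k - 1. Every
-- other row of length p is the p low bits of k - 1 or their complement, according to bit p of
-- k - 1, so 2^p - 1 - row_p is either (k - 1) mod 2^p or 2^p - 1 - ((k - 1) mod 2^p); this is
-- S^(2^p)(k) - 1, because the alternating cycle runs up when ⌊(k - 1) / 2^p⌋ is odd and down
-- when it is even.
module Submission where

open import Defs
open import Data.Nat using (ℕ; zero; suc; _+_; _*_; _∸_; _^_; _≤_; _<_; _≡ᵇ_; s≤s; NonZero)
open import Data.Nat.Properties
open import Data.Nat.DivMod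
open import Data.Nat.Divisibility using (_∣_; divides; ∣-refl; n∣m*n)
open import Data.Nat.Tactic.RingSolver using (solve-∀)
open import Data.Bool using (Bool; true; false; if_then_else_; _xor_; not)
open import Data.List using (List; []; _∷_; _++_; map; concat; concatMap; foldl; length)
open import Data.List.Properties
  using (foldl-++; map-++; map-∘; map-id; length-++; length-map; concatMap-cong; map-concatMap)
open import Data.Product using (_×_; _,_)
import Data.Product as Product
open import Function using (_∘_)
open import Relation.Binary.PropositionalEquality
open ≡-Reasoning

m≡n+o+1⇒n≡m∸1∸o : ∀ {m n o} → m ≡ n + o + 1 → n ≡ m ∸ 1 ∸ o
m≡n+o+1⇒n≡m∸1∸o {n = n} {o} refl = sym (trans (cong (_∸ o) (m+n∸n≡m (n + o) 1)) (m+n∸n≡m n o))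

m<n⇒m+[n∸m∸1]+1≡n : ∀ {m n} → m < n → m + (n ∸ m ∸ 1) + 1 ≡ n
m<n⇒m+[n∸m∸1]+1≡n {zero}  {suc n} _         = +-comm n 1
m<n⇒m+[n∸m∸1]+1≡n {suc m} {suc n} (s≤s m<n) = cong suc (m<n⇒m+[n∸m∸1]+1≡n m<n)

^-monoʳ-∣ : ∀ m {n o} → n ≤ o → m ^ n ∣ m ^ o
^-monoʳ-∣ m {n} {o} n≤o =
  divides (m ^ (o ∸ n)) (trans (cong (m ^_) (sym (m∸n+n≡m n≤o))) (^-distribˡ-+-* m (o ∸ n) n))

m/n%o*n+m%n≡m%[o*n] : ∀ m n o .{{_ : NonZero n}} .{{_ : NonZero o}} {{_ : NonZero (o * n)}} →
                      m / n % o * n + m % n ≡ m % (o * n)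
m/n%o*n+m%n≡m%[o*n] m n o = sym (begin
    m % (o * n)
  ≡⟨ m≡m%n+[m/n]*n (m % (o * n)) n ⟩
    m % (o * n) % n + m % (o * n) / n * n
  ≡⟨ cong₂ (λ r q → r + q * n) (m∣n⇒o%n%m≡o%m n (o * n) m (n∣m*n o)) (m%[n*o]/o≡m/o%n m o n) ⟩
    m % n + m / n % o * n
  ≡⟨ +-comm (m % n) _ ⟩
    m / n % o * n + m % n ∎)

choose2-suc : ∀ c → choose2 (suc c) ≡ choose2 c + c
choose2-suc zero    = refl
choose2-suc (suc d) = begin
    suc (suc d) * suc d / 2
  ≡⟨ cong (_/ 2) (expand d) ⟩
    (suc d * d + suc d * 2) / 2
  ≡⟨ +-distrib-/-∣ʳ (suc d * d) (n∣m*n (suc d)) ⟩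
    suc d * d / 2 + suc d * 2 / 2
  ≡⟨ cong (suc d * d / 2 +_) (m*n/n≡m (suc d) 2) ⟩
    choose2 (suc d) + suc d ∎
  where
  expand : ∀ d → suc (suc d) * suc d ≡ suc d * d + suc d * 2
  expand = solve-∀

map-upFrom-suc : ∀ {A : Set} (f : ℕ → A) s c →
                 map f (upFrom (suc s) c) ≡ map (f ∘ suc) (upFrom s c)
map-upFrom-suc f s zero    = refl
map-upFrom-suc f s (suc c) = cong (f (suc s) ∷_) (map-upFrom-suc f (suc s) c)

length-upFrom : ∀ s c → length (upFrom s c) ≡ c
length-upFrom s zero    = refl
length-upFrom s (suc c) = cong suc (length-upFrom (suc s) c)

bitValue : Bool → ℕ
bitValue b = if b then 1 else 0

code-step : ℕ → Bool → ℕ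
code-step acc b = 2 * acc + bitValue b

foldl-code : ∀ acc l → foldl code-step acc l ≡ acc * 2 ^ length l + code l
foldl-code acc []      = sym (trans (+-identityʳ _) (*-identityʳ acc))
foldl-code acc (b ∷ l) = begin
    foldl code-step (2 * acc + bitValue b) l
  ≡⟨ foldl-code (2 * acc + bitValue b) l ⟩
    (2 * acc + bitValue b) * 2 ^ length l + code l
  ≡⟨ regroup acc (bitValue b) (2 ^ length l) (code l) ⟩
    acc * 2 ^ suc (length l) + (bitValue b * 2 ^ length l + code l)
  ≡⟨ cong (acc * 2 ^ suc (length l) +_) (foldl-code (bitValue b) l) ⟨
    acc * 2 ^ length (b ∷ l) + code (b ∷ l) ∎
  where
  regroup : ∀ a v P c → (2 * a + v) * P + c ≡ a * (2 * P) + (v * P + c)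
  regroup = solve-∀

code-∷ : ∀ b l → code (b ∷ l) ≡ bitValue b * 2 ^ length l + code l
code-∷ b = foldl-code (bitValue b)

code-++ : ∀ l l′ → code (l ++ l′) ≡ code l * 2 ^ length l′ + code l′
code-++ l l′ = trans (foldl-++ code-step 0 l l′) (foldl-code (code l) l′)

code-map-not : ∀ l → code (map not l) + code l + 1 ≡ 2 ^ length l
code-map-not []      = refl
code-map-not (b ∷ l) = begin
    code (not b ∷ map not l) + code (b ∷ l) + 1
  ≡⟨ cong₂ (λ x y → x + y + 1) (code-∷ (not b) (map not l)) (code-∷ b l) ⟩
    bitValue (not b) * 2 ^ length (map not l) + c̄ + (bitValue b * P + c) + 1
  ≡⟨ cong (λ L → bitValue (not b) * 2 ^ L + c̄ + (bitValue b * P + c) + 1) (length-map not l) ⟩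
    bitValue (not b) * P + c̄ + (bitValue b * P + c) + 1
  ≡⟨ regroup (bitValue (not b)) (bitValue b) P c̄ c ⟩
    (bitValue (not b) + bitValue b) * P + (c̄ + c + 1)
  ≡⟨ cong₂ (λ v r → v * P + r) (bitValue-not b) (code-map-not l) ⟩
    1 * P + P
  ≡⟨ double P ⟩
    2 * P ∎
  where
  P = 2 ^ length l
  c = code l
  c̄ = code (map not l)
  regroup : ∀ v̄ v P c̄ c → v̄ * P + c̄ + (v * P + c) + 1 ≡ (v̄ + v) * P + (c̄ + c + 1)
  regroup = solve-∀
  double : ∀ P → 1 * P + P ≡ 2 * P
  double = solve-∀
  bitValue-not : ∀ b → bitValue (not b) + bitValue b ≡ 1
  bitValue-not true  = refl
  bitValue-not false = refl

cutRow : Bool → List Bool → List Bool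
cutRow b = map (b xor_)

cut : List Bool → List Bool
cut []      = []
cut (b ∷ l) = cutRow b l ++ cut l

length-cut : ∀ l → length (cut l) ≡ choose2 (length l)
length-cut []      = refl
length-cut (b ∷ l) = begin
    length (cutRow b l ++ cut l)
  ≡⟨ length-++ (cutRow b l) ⟩
    length (cutRow b l) + length (cut l)
  ≡⟨ cong₂ _+_ (length-map (b xor_) l) (length-cut l) ⟩
    length l + choose2 (length l)
  ≡⟨ +-comm (length l) _ ⟩
    choose2 (length l) + length l
  ≡⟨ choose2-suc (length l) ⟨
    choose2 (suc (length l)) ∎

code-cut-∷ : ∀ b l → code (cut (b ∷ l)) ≡ code (cutRow b l) * 2 ^ choose2 (length l) + code (cut l)
code-cut-∷ b l = trans (code-++ (cutRow b l) (cut l))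
                       (cong (λ L → code (cutRow b l) * 2 ^ L + code (cut l)) (length-cut l))

cut-∷-complement : ∀ b l {c e s} → length l ≡ c →
                   code (cutRow b l) + e + 1 ≡ 2 ^ c →
                   code (cut l) + s + 1 ≡ 2 ^ choose2 c →
                   code (cut (b ∷ l)) + (2 ^ choose2 c * e + s) + 1 ≡ 2 ^ choose2 (suc c)
cut-∷-complement b l {e = e} {s} refl row-complement cut-complement = begin
    code (cut (b ∷ l)) + (P * e + s) + 1
  ≡⟨ cong (λ x → x + (P * e + s) + 1) (code-cut-∷ b l) ⟩
    r * P + t + (P * e + s) + 1
  ≡⟨ regroup r t P e s ⟩
    P * (r + e) + (t + s + 1)
  ≡⟨ cong (λ x → P * (r + e) + x) cut-complement ⟩
    P * (r + e) + P
  ≡⟨ factor P (r + e) ⟩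
    P * (r + e + 1)
  ≡⟨ cong (P *_) row-complement ⟩
    P * 2 ^ length l
  ≡⟨ ^-distribˡ-+-* 2 (choose2 (length l)) (length l) ⟨
    2 ^ (choose2 (length l) + length l)
  ≡⟨ cong (2 ^_) (choose2-suc (length l)) ⟨
    2 ^ choose2 (suc (length l)) ∎
  where
  P = 2 ^ choose2 (length l)
  r = code (cutRow b l)
  t = code (cut l)
  regroup : ∀ r t P e s → r * P + t + (P * e + s) + 1 ≡ P * (r + e) + (t + s + 1)
  regroup = solve-∀
  factor : ∀ P x → P * x + P ≡ P * (x + 1)
  factor = solve-∀

pairs-suc : ∀ n → pairs (suc n) ≡ map (1 ,_) (upFrom 2 n) ++ map (Product.map suc suc) (pairs n)
pairs-suc n = cong (map (1 ,_) (upFrom 2 n) ++_) (begin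
    concatMap row′ (upFrom 2 n)
  ≡⟨ cong concat (map-upFrom-suc row′ 1 n) ⟩
    concatMap (row′ ∘ suc) (upFrom 1 n)
  ≡⟨ concatMap-cong shift (upFrom 1 n) ⟩
    concatMap (map (Product.map suc suc) ∘ row) (upFrom 1 n)
  ≡⟨ map-concatMap (Product.map suc suc) row (upFrom 1 n) ⟨
    map (Product.map suc suc) (pairs n) ∎)
  where
  row row′ : ℕ → List (ℕ × ℕ)
  row  i = map (i ,_) (upFrom (suc i) (n ∸ i))
  row′ i = map (i ,_) (upFrom (suc i) (suc n ∸ i))
  shift : ∀ i → row′ (suc i) ≡ map (Product.map suc suc) (row i)
  shift i = trans (map-upFrom-suc (suc i ,_) (suc i) (n ∸ i)) (map-∘ (upFrom (suc i) (n ∸ i)))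

cutVec-suc : ∀ n S → cutVec (suc n) S ≡ map (λ j → S 1 xor S j) (upFrom 2 n) ++ cutVec n (S ∘ suc)
cutVec-suc n S = begin
    map _ (pairs (suc n))
  ≡⟨ cong (map _) (pairs-suc n) ⟩
    map _ (map (1 ,_) (upFrom 2 n) ++ map (Product.map suc suc) (pairs n))
  ≡⟨ map-++ _ (map (1 ,_) (upFrom 2 n)) _ ⟩
    map _ (map (1 ,_) (upFrom 2 n)) ++ map _ (map (Product.map suc suc) (pairs n))
  ≡⟨ cong₂ _++_ (map-∘ (upFrom 2 n)) (map-∘ (pairs n)) ⟨
    map (λ j → S 1 xor S j) (upFrom 2 n) ++ cutVec n (S ∘ suc) ∎

cutVec≡cut : ∀ n S → cutVec n S ≡ cut (map S (upFrom 1 n))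
cutVec≡cut zero    S = refl
cutVec≡cut (suc n) S = begin
    cutVec (suc n) S
  ≡⟨ cutVec-suc n S ⟩
    map (λ j → S 1 xor S j) (upFrom 2 n) ++ cutVec n (S ∘ suc)
  ≡⟨ cong₂ _++_ (map-∘ (upFrom 2 n)) (cutVec≡cut n (S ∘ suc)) ⟩
    cutRow (S 1) (map S (upFrom 2 n)) ++ cut (map (S ∘ suc) (upFrom 1 n))
  ≡⟨ cong (λ l → cutRow (S 1) (map S (upFrom 2 n)) ++ cut l) (map-upFrom-suc S 1 n) ⟨
    cut (map S (upFrom 1 (suc n))) ∎

map-entry-upFrom : ∀ {n} l → length l ≡ n → map (entry l) (upFrom 1 n) ≡ l
map-entry-upFrom []      refl = refl
map-entry-upFrom (b ∷ l) refl = cong (b ∷_) (begin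
    map (entry (b ∷ l)) (upFrom 2 (length l))
  ≡⟨ map-upFrom-suc (entry (b ∷ l)) 1 (length l) ⟩
    map (entry (b ∷ l) ∘ suc) (upFrom 1 (length l))
  ≡⟨ map-upFrom-suc (entry (b ∷ l) ∘ suc) 0 (length l) ⟩
    map (entry l ∘ suc) (upFrom 0 (length l))
  ≡⟨ map-upFrom-suc (entry l) 0 (length l) ⟨
    map (entry l) (upFrom 1 (length l))
  ≡⟨ map-entry-upFrom l refl ⟩
    l ∎)

bit : ℕ → ℕ → Bool
bit a p = a / 2 ^ p % 2 ≡ᵇ 1
  where instance _ = m^n≢0 2 p

_%2^_ : ℕ → ℕ → ℕ
a %2^ p = a % 2 ^ p
  where instance _ = m^n≢0 2 p

bit-2^+-low : ∀ {p q} m → q < p → bit (2 ^ p + m) q ≡ bit m q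
bit-2^+-low {p} {q} m q<p = cong (_≡ᵇ 1) (begin
    (2 ^ p + m) / 2 ^ q % 2
  ≡⟨ m%[n*o]/o≡m/o%n (2 ^ p + m) 2 (2 ^ q) ⟨
    (2 ^ p + m) % 2 ^ suc q / 2 ^ q
  ≡⟨ cong (_/ 2 ^ q) (%-remove-+ˡ m (^-monoʳ-∣ 2 q<p)) ⟩
    m % 2 ^ suc q / 2 ^ q
  ≡⟨ m%[n*o]/o≡m/o%n m 2 (2 ^ q) ⟩
    m / 2 ^ q % 2 ∎)
  where instance
          _ = m^n≢0 2 q
          _ = m^n≢0 2 (suc q)

bit-2^+-top : ∀ p {m} → m < 2 ^ p → bit (2 ^ p + m) p ≡ true
bit-2^+-top p {m} m<2^p = cong (λ x → x % 2 ≡ᵇ 1) (begin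
    (2 ^ p + m) / 2 ^ p
  ≡⟨ +-distrib-/-∣ˡ m ∣-refl ⟩
    2 ^ p / 2 ^ p + m / 2 ^ p
  ≡⟨ cong₂ _+_ (n/n≡1 (2 ^ p)) (m<n⇒m/n≡0 m<2^p) ⟩
    1 ∎)
  where instance _ = m^n≢0 2 p

decode-suc : ∀ n a → decode (suc n) a ≡ bit a n ∷ decode n a
decode-suc n a = cong (bit a n ∷_) (map-upFrom-suc (λ i → bit a (suc n ∸ i)) 1 n)

length-decode : ∀ n a → length (decode n a) ≡ n
length-decode n a = trans (length-map _ (upFrom 1 n)) (length-upFrom 1 n)

decode-cong : ∀ n {a b} → (∀ q → q < n → bit a q ≡ bit b q) → decode n a ≡ decode n b
decode-cong zero    _          = refl
decode-cong (suc n) {a} {b} same-bits = begin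
    decode (suc n) a
  ≡⟨ decode-suc n a ⟩
    bit a n ∷ decode n a
  ≡⟨ cong₂ _∷_ (same-bits n ≤-refl) (decode-cong n (λ q q<n → same-bits q (m<n⇒m<1+n q<n))) ⟩
    bit b n ∷ decode n b
  ≡⟨ decode-suc n b ⟨
    decode (suc n) b ∎

decode-2^+ : ∀ p {m} → m < 2 ^ p → decode (suc p) (2 ^ p + m) ≡ true ∷ decode p m
decode-2^+ p {m} m<2^p = trans (decode-suc p (2 ^ p + m))
  (cong₂ _∷_ (bit-2^+-top p m<2^p) (decode-cong p (λ _ → bit-2^+-low m)))

code-decode : ∀ p a → code (decode p a) ≡ a %2^ p
code-decode zero    a = sym (n%1≡0 a)
code-decode (suc p) a = begin
    code (decode (suc p) a)
  ≡⟨ cong code (decode-suc p a) ⟩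
    code (bit a p ∷ decode p a)
  ≡⟨ code-∷ (bit a p) (decode p a) ⟩
    bitValue (bit a p) * 2 ^ length (decode p a) + code (decode p a)
  ≡⟨ cong₂ (λ L c → bitValue (bit a p) * 2 ^ L + c) (length-decode p a) (code-decode p a) ⟩
    bitValue (bit a p) * 2 ^ p + a % 2 ^ p
  ≡⟨ cong (λ d → d * 2 ^ p + a % 2 ^ p) (bitValue-≡ᵇ1 (a / 2 ^ p % 2) (m%n<n (a / 2 ^ p) 2)) ⟩
    a / 2 ^ p % 2 * 2 ^ p + a % 2 ^ p
  ≡⟨ m/n%o*n+m%n≡m%[o*n] a (2 ^ p) 2 ⟩
    a %2^ suc p ∎
  where
  instance
    _ = m^n≢0 2 p
    _ = m^n≢0 2 (suc p)
  bitValue-≡ᵇ1 : ∀ y → y < 2 → bitValue (y ≡ᵇ 1) ≡ y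
  bitValue-≡ᵇ1 0 _ = refl
  bitValue-≡ᵇ1 1 _ = refl
  bitValue-≡ᵇ1 (suc (suc _)) (s≤s (s≤s ()))

code-map-not-decode : ∀ p a → code (map not (decode p a)) + a %2^ p + 1 ≡ 2 ^ p
code-map-not-decode p a =
  subst₂ (λ c L → code (map not (decode p a)) + c + 1 ≡ 2 ^ L)
         (code-decode p a) (length-decode p a) (code-map-not (decode p a))

altCycle-suc : ∀ N .{{_ : NonZero N}} a →
               altCycle N (suc a) ≡ (if a / N % 2 ≡ᵇ 0 then N ∸ a % N else suc (a % N))
altCycle-suc N a = cong (λ r → if a / N % 2 ≡ᵇ 0 then suc N ∸ r else r) (begin
    suc a ∸ a / N * N
  ≡⟨ cong (λ x → suc x ∸ a / N * N) (m≡m%n+[m/n]*n a N) ⟩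
    suc (a % N) + a / N * N ∸ a / N * N
  ≡⟨ m+n∸n≡m (suc (a % N)) (a / N * N) ⟩
    suc (a % N) ∎)

code-cutRow-decode : ∀ a p →
  code (cutRow (bit a p) (decode p a)) + (altCyclePow2 p (suc a) ∸ 1) + 1 ≡ 2 ^ p
code-cutRow-decode a p = begin
    code (cutRow (bit a p) l) + (altCyclePow2 p (suc a) ∸ 1) + 1
  ≡⟨ cong (λ r → code (cutRow (bit a p) l) + (r ∸ 1) + 1) (altCycle-suc (2 ^ p) a) ⟩
    code (cutRow (bit a p) l) + ((if a / 2 ^ p % 2 ≡ᵇ 0 then 2 ^ p ∸ a % 2 ^ p else suc (a % 2 ^ p)) ∸ 1) + 1
  ≡⟨ by-parity (a / 2 ^ p % 2) (m%n<n (a / 2 ^ p) 2) ⟩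
    2 ^ p ∎
  where
  instance _ = m^n≢0 2 p
  l = decode p a
  by-parity : ∀ y → y < 2 →
    code (cutRow (y ≡ᵇ 1) l) + ((if y ≡ᵇ 0 then 2 ^ p ∸ a % 2 ^ p else suc (a % 2 ^ p)) ∸ 1) + 1 ≡ 2 ^ p
  by-parity 0 _ = trans (cong (λ c → c + (2 ^ p ∸ a % 2 ^ p ∸ 1) + 1)
                              (trans (cong code (map-id l)) (code-decode p a)))
                        (m<n⇒m+[n∸m∸1]+1≡n (m%n<n a (2 ^ p)))
  by-parity 1 _ = code-map-not-decode p a
  by-parity (suc (suc _)) (s≤s (s≤s ()))

code-cut-decode : ∀ a c →
  code (cut (decode (suc c) a)) + sumTo c (λ j → 2 ^ choose2 j * (altCyclePow2 j (suc a) ∸ 1)) + 1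
    ≡ 2 ^ choose2 (suc c)
code-cut-decode a zero    = refl
code-cut-decode a (suc c) = begin
    code (cut (decode (suc (suc c)) a)) + (Σ + P * e) + 1
  ≡⟨ cong₂ (λ l s → code (cut l) + s + 1) (decode-suc (suc c) a) (+-comm Σ (P * e)) ⟩
    code (cut (bit a (suc c) ∷ decode (suc c) a)) + (P * e + Σ) + 1
  ≡⟨ cut-∷-complement (bit a (suc c)) (decode (suc c) a) (length-decode (suc c) a)
                      (code-cutRow-decode a (suc c)) (code-cut-decode a c) ⟩
    2 ^ choose2 (suc (suc c)) ∎
  where
  Σ = sumTo c (λ j → 2 ^ choose2 j * (altCyclePow2 j (suc a) ∸ 1))
  P = 2 ^ choose2 (suc c)
  e = altCyclePow2 (suc c) (suc a) ∸ 1

w≡code-cut-decode : ∀ n k → w n k ≡ code (cut (decode n (2 ^ (n ∸ 1) + k ∸ 1)))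
w≡code-cut-decode n k =
  cong code (trans (cutVec≡cut n (entry x)) (cong cut (map-entry-upFrom x (length-decode n _))))
  where x = decode n (2 ^ (n ∸ 1) + k ∸ 1)

w-formula : ∀ N m → m < 2 ^ suc N →
  w (suc (suc N)) (suc m) ≡ (2 ^ choose2 (suc (suc N)) ∸ 1)
    ∸ (2 ^ choose2 (suc N) * m + sumTo N (λ j → 2 ^ choose2 j * (altCyclePow2 j (suc m) ∸ 1)))
w-formula N m m<2^[1+N] = m≡n+o+1⇒n≡m∸1∸o (begin
    2 ^ choose2 (suc (suc N))
  ≡⟨ cut-∷-complement true x (length-decode (suc N) m) top-row (code-cut-decode m N) ⟨
    code (cut (true ∷ x)) + Y + 1
  ≡⟨ cong (λ v → v + Y + 1) w≡code-cut ⟨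
    w (suc (suc N)) (suc m) + Y + 1 ∎)
  where
  instance _ = m^n≢0 2 (suc N)
  x = decode (suc N) m
  Y = 2 ^ choose2 (suc N) * m + sumTo N (λ j → 2 ^ choose2 j * (altCyclePow2 j (suc m) ∸ 1))
  top-row : code (cutRow true x) + m + 1 ≡ 2 ^ suc N
  top-row = subst (λ r → code (map not x) + r + 1 ≡ 2 ^ suc N)
                  (m<n⇒m%n≡m m<2^[1+N]) (code-map-not-decode (suc N) m)
  w≡code-cut : w (suc (suc N)) (suc m) ≡ code (cut (true ∷ x))
  w≡code-cut = begin
      w (suc (suc N)) (suc m)
    ≡⟨ w≡code-cut-decode (suc (suc N)) (suc m) ⟩
      code (cut (decode (suc (suc N)) (2 ^ suc N + suc m ∸ 1)))
    ≡⟨ cong (λ a → code (cut (decode (suc (suc N)) a))) (cong (_∸ 1) (+-suc (2 ^ suc N) m)) ⟩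
      code (cut (decode (suc (suc N)) (2 ^ suc N + m)))
    ≡⟨ cong (code ∘ cut) (decode-2^+ (suc N) m<2^[1+N]) ⟩
      code (cut (true ∷ x)) ∎

corollary3 : (n k : ℕ) → 3 ≤ n → 1 ≤ k → k ≤ 2 ^ (n ∸ 1) →
    w n k ≡ (2 ^ choose2 n ∸ 1)
              ∸ (2 ^ choose2 (n ∸ 1) * (k ∸ 1)
                 + sumTo (n ∸ 2) (λ j → 2 ^ choose2 j * (altCyclePow2 j k ∸ 1)))
corollary3 (suc (suc (suc n))) (suc m) _ _ m<2^[n-1] = w-formula (suc n) m m<2^[n-1]
corollary3 (suc (suc (suc n))) zero    _ () _
corollary3 (suc (suc zero))    _ (s≤s (s≤s ())) _ _
corollary3 (suc zero)          _ (s≤s ()) _ _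
corollary3 zero                _ () _ _
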